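{- Let $f$ be a phylogenetic payoff function of arity $k$, let $\mathcal{G}=\mathcal{I}^f_{gap}$ be a gap instance on $m$ variables, let $\Gamma_{ord}$ be the corresponding ordering CSP and $h_{ord\to phy}$ the corresponding reduction. Then for every instance $\mathcal{I}_{ord}$ of $\Gamma_{ord}$ and $\mathcal{I}_{phy}=h_{ord\to phy}(\mathcal{I}_{ord})$, $\mathrm{opt}(\mathcal{I}_{ord})\ge\mathrm{opt}(\mathcal{I}_{phy})$.
   Context: Trees: finite rooted trees in which every internal node has exactly two children, ordered as left and right; leaves are ordered left to right. A pattern on $x_1,\dots,x_k$ is such a tree with $k$ leaves bijectively labelled by $x_1,\dots,x_k$; distinct variables injectively placed at leaves match $P$ if $P$ is obtained by deleting unassigned leaves and contracting unary nodes (preserving labels and order). A payoff function $f$ assigns a payoff in $[0,1]$ to each pattern; $f(y_1,\dots,y_k)$ is the payoff of the matched pattern. A phylogenetic instance is a finite variable set with a probability distribution over constraints on distinct variables; a solution $\varphi$ is an injective map to leaves of a tree; its value is the expected payoff; $\mathrm{opt}$ is the maximum. $\mathrm{order}(\varphi)$ is the left-to-right order of images; $\mathrm{opt}(\mathcal{I}\mid\pi)$ is the maximum value over solutions with $\mathrm{order}(\varphi)=\pi$. Gap instance: $T$ is a perfect ordered $k$-ary tree of depth $d$ with leaves $y_1,\dots,y_m$, $m=k^d$. Random tuple: $t$ uniform in $\{0,\dots,d-1\}$, $u$ uniform at depth $t$ with children $u_1,\dots,u_k$, $l_j$ independently uniform among leaves under $u_j$; $\mathcal{G}$ has constraint $f(a_1,\dots,a_k)$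 with weight $\Pr[(l_1,\dots,l_k)=(a_1,\dots,a_k)]$. Ordering CSP $\Gamma_{ord}$: payoff $o$ of arity $m$; for distinct $z_1,\dots,z_m$ and an ordering $\pi$ of them, $o(z_1,\dots,z_m)$ on $\pi$ equals $\mathrm{opt}(\mathcal{G}[z]\mid\pi)$, $\mathcal{G}[z]$ being the copy of $\mathcal{G}$ with $y_j$ replaced by $z_j$. An instance is a probability distribution over constraints $o(z_1,\dots,z_m)$; a solution is a linear ordering of all variables, valued by the expected value of $o$ on the induced orderings; $\mathrm{opt}$ is the maximum. Reduction: $h_{ord\to phy}(\mathcal{I}_{ord})$ is the phylogenetic instance on the same variables whose random constraint is obtained by drawing $o(z_1,\dots,z_m)$ from $\mathcal{I}_{ord}$ and then a random constraint of $\mathcal{G}[z]$.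
   Formalization: The payoffs of f are rational numbers in [0,1], and the constraint probabilities of the instance $\mathcal{I}_{ord}$ are rational. -}

module Defs where

open import Data.Nat as ℕ using (ℕ; zero; suc; _^_)
open import Data.Bool using (Bool; true; false; _∧_; if_then_else_)
open import Data.Fin as Fin using (Fin; zero; suc; toℕ; _↑ˡ_; _↑ʳ_; inject; combine; _≟_)
open import Data.Fin.Base using () renaming (_<_ to _<ᶠ_)
open import Data.List as List using (List; []; _∷_; [_]; concatMap; filterᵇ; length; foldr)
open import Data.Bool.ListAction using (and)
open import Data.Vec as Vec using (Vec; []; _∷_; lookup; tabulate)
open import Data.Maybe as Maybe using (Maybe; just; nothing; maybe)
open import Data.Product using (Σ; Σ-syntax; ∃; _×_; _,_)
open import Data.Integer using (+_)
open import Data.Rational using (ℚ; 0ℚ; 1ℚ; _+_; _*_; _≤_; _/_)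
open import Relation.Nullary.Decidable using (⌊_⌋)
open import Relation.Binary.PropositionalEquality using (_≡_)
open import Function.Definitions using (Injective)

data Tree : Set where
  leaf : Tree
  node : Tree → Tree → Tree

-- number of leaves; leaves are indexed left-to-right by Fin (size T)
size : Tree → ℕ
size leaf       = 1
size (node l r) = size l ℕ.+ size r

-- Trees whose leaves carry labels (patterns are LTree (Fin k) whose
-- leaf labels are exactly 0..k-1, each once).
data LTree (A : Set) : Set where
  lf : A → LTree A
  nd : LTree A → LTree A → LTree A

-- joining two restricted subtrees: an empty side disappears and the
-- resulting unary node is contracted
join : {A : Set} → Maybe (LTree A) → Maybe (LTree A) → Maybe (LTree A)
join nothing  y        = y
join (just x) nothing  = just x
join (just x) (just y) = just (nd x y)

restrict : {A : Set} (T : Tree) → (Fin (size T) → Maybe A) → Maybe (LTree A)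
restrict leaf       g = Maybe.map lf (g zero)
restrict (node l r) g =
  join (restrict l (λ i → g (i ↑ˡ size r))) (restrict r (λ i → g (size l ↑ʳ i)))

preimage : {L k : ℕ} → Vec (Fin L) k → Fin L → Maybe (Fin k)
preimage []       j = nothing
preimage (x ∷ xs) j = if ⌊ x ≟ j ⌋ then just zero else Maybe.map suc (preimage xs j)

matched : {k : ℕ} (T : Tree) → Vec (Fin (size T)) k → Maybe (LTree (Fin k))
matched T a = restrict T (preimage a)

-- payoff of leaves a₁..a_k under payoff function f
-- (the 'nothing' case only occurs for k = 0, which is excluded)
payoff : {k : ℕ} → (LTree (Fin k) → ℚ) → (T : Tree) → Vec (Fin (size T)) k → ℚ
payoff f T a = maybe f 0ℚ (matched T a)

Dist : Set → Set
Dist A = List (ℚ × A)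

uniform : {A : Set} → List A → Dist A
uniform []       = []
uniform (x ∷ xs) = List.map (λ y → ((+ 1) / suc (length xs)) , y) (x ∷ xs)

returnD : {A : Set} → A → Dist A
returnD x = [ (1ℚ , x) ]

bindD : {A B : Set} → Dist A → (A → Dist B) → Dist B
bindD d f = concatMap (λ { (w , x) → List.map (λ { (v , y) → (w * v , y) }) (f x) }) d

mapD : {A B : Set} → (A → B) → Dist A → Dist B
mapD f = List.map (λ { (w , x) → (w , f x) })

seqD : {A : Set} {k : ℕ} → Vec (Dist A) k → Dist (Vec A k)
seqD []       = returnD []
seqD (d ∷ ds) = bindD d (λ x → mapD (x ∷_) (seqD ds))

expect : {A : Set} → Dist A → (A → ℚ) → ℚ
expect d g = foldr (λ { (w , x) acc → w * g x + acc }) 0ℚ d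

totalWeight : {A : Set} → Dist A → ℚ
totalWeight d = foldr (λ { (w , _) acc → w + acc }) 0ℚ d

IsDist : {A : Set} → Dist A → Set
IsDist d = List.foldr (λ { (w , _) P → (0ℚ ≤ w) × P }) (0ℚ ≡ 0ℚ) d × (totalWeight d ≡ 1ℚ)

AllOutcomes : {A : Set} → (A → Set) → Dist A → Set
AllOutcomes P d = List.foldr (λ { (_ , x) Q → P x × Q }) (0ℚ ≡ 0ℚ) d

vecsOf : {A : Set} → List A → (n : ℕ) → List (Vec A n)
vecsOf xs zero    = [ [] ]
vecsOf xs (suc n) = concatMap (λ x → List.map (x ∷_) (vecsOf xs n)) xs

-- leaves of the perfect k-ary tree of depth d are root-to-leaf paths;
-- their left-to-right index (lexicographic order)
rank : {k d : ℕ} → Vec (Fin k) d → Fin (k ^ d)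
rank []       = zero
rank (x ∷ xs) = combine x (rank xs)

-- is leaf l below the j-th child of the node u at depth t ?
under : {k d : ℕ} (t : Fin d) → Vec (Fin k) (toℕ t) → Fin k → Vec (Fin k) d → Bool
under t u j l =
  and (List.map (λ i → ⌊ lookup l (inject i) ≟ lookup u i ⌋) (List.allFin (toℕ t)))
  ∧ ⌊ lookup l t ≟ j ⌋

gapTuples : (k d : ℕ) → Dist (Vec (Vec (Fin k) d) k)
gapTuples k d =
  bindD (uniform (List.allFin d)) λ t →
  bindD (uniform (vecsOf (List.allFin k) (toℕ t))) λ u →
  seqD (tabulate λ j → uniform (filterᵇ (under t u j) (vecsOf (List.allFin k) d)))

-- gap instance 𝒢 on variables y₁..y_m (m = k^d) as a distribution of
-- constraints f(a₁,…,a_k)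
gap : (k d : ℕ) → Dist (Vec (Fin (k ^ d)) k)
gap k d = mapD (Vec.map rank) (gapTuples k d)

phyValue : {k n : ℕ} → (LTree (Fin k) → ℚ) → Dist (Vec (Fin n) k)
         → (T : Tree) → (Fin n → Fin (size T)) → ℚ
phyValue f I T φ = expect I (λ a → payoff f T (Vec.map φ a))

hOrdPhy : (k d : ℕ) {n : ℕ} → Dist (Vec (Fin n) (k ^ d)) → Dist (Vec (Fin n) k)
hOrdPhy k d I = bindD I (λ z → mapD (Vec.map (lookup z)) (gap k d))

-- ψ (a solution of 𝒢[z], z_j ↦ ψ j) has order equal to the ordering
-- induced by σ on z₁..z_m
OrderIs : {m n : ℕ} (T : Tree) → (Fin m → Fin (size T))
        → Vec (Fin n) m → (Fin n → Fin n) → Set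
OrderIs T ψ z σ = ∀ i j →
  ((ψ i <ᶠ ψ j → σ (lookup z i) <ᶠ σ (lookup z j)) ×
   (σ (lookup z i) <ᶠ σ (lookup z j) → ψ i <ᶠ ψ j))

IsOptGiven : (k d : ℕ) {n : ℕ} → (LTree (Fin k) → ℚ)
           → Vec (Fin n) (k ^ d) → (Fin n → Fin n) → ℚ → Set
IsOptGiven k d f z σ v =
  (Σ[ T ∈ Tree ] Σ[ ψ ∈ (Fin (k ^ d) → Fin (size T)) ]
     Injective _≡_ _≡_ ψ × OrderIs T ψ z σ × phyValue f (gap k d) T ψ ≡ v)
  × (∀ (T : Tree) (ψ : Fin (k ^ d) → Fin (size T)) →
       Injective _≡_ _≡_ ψ → OrderIs T ψ z σ → phyValue f (gap k d) T ψ ≤ v)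

-- value of an ordering solution σ (σ x = position of x) of I_ord,
-- given the payoff o
ordValue : {m n : ℕ} → (Vec (Fin n) m → (Fin n → Fin n) → ℚ)
         → Dist (Vec (Fin n) m) → (Fin n → Fin n) → ℚ
ordValue o I σ = expect I (λ z → o z σ)

{-# OPTIONS --safe #-}
-- Given a phylogenetic solution φ, order the variables by the left-to-right position of their
-- leaves.  For every constraint o(z) of I, φ restricted to z is a solution of the copy 𝒢[z] whose
-- leaf order is exactly the order induced on z, so its value is at most o(z) by the definition of
-- o.  The value of φ on h(I) is the I-average of these copy values, hence at most the value of
-- the ordering.
module Submission where

open import Defs
open import Data.Nat using (ℕ; _^_; _≤_; _<_)
open import Data.Fin using (Fin; toℕ; fromℕ<) renaming (_<_ to _<ᶠ_)
open import Data.Vec using (Vec; lookup; tabulate)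
open import Data.Product using (Σ-syntax; _×_; _,_; proj₂)
open import Data.Rational using (ℚ; 0ℚ; 1ℚ) renaming (_≤_ to _≤ℚ_)
open import Relation.Binary.PropositionalEquality using (_≡_)
open import Function.Definitions using (Injective)

open import Data.Fin.Properties using (_<?_; <-cmp; toℕ-fromℕ<)
open import Data.Fin.Subset using (Subset; _∈_; _⊂_; ⊤; ∣_∣)
open import Data.Fin.Subset.Properties using (∈⊤; ∣⊤∣≡n; p⊂q⇒∣p∣<∣q∣)
open import Data.List using ([]; _∷_; _++_)
import Data.List as List
open import Data.Nat.Properties using (<-irrefl; <-asym; <-trans)
open import Data.Rational using (_+_; _*_; nonNegative)
open import Data.Rational.Properties
  using (+-identityˡ; +-assoc; *-zeroʳ; *-assoc; *-distribˡ-+; ≤-refl; +-mono-≤; *-monoˡ-≤-nonNeg)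
  renaming (module ≤-Reasoning to ℚ-≤-Reasoning)
import Data.Vec as Vec
open import Data.Vec.Properties using (lookup⇒[]=; []=⇒lookup; lookup∘tabulate; map-∘)
open import Function using (_∘_)
open import Relation.Binary.Definitions using (tri<; tri≈; tri>)
open import Relation.Binary.PropositionalEquality using (refl; sym; trans; cong; cong₂; subst; subst₂; module ≡-Reasoning)
open import Relation.Nullary using (¬_; contradiction)
open import Relation.Nullary.Decidable using (does; proof; dec-true)
open import Relation.Nullary.Reflects using (Reflects; invert)

expect-++ : {A : Set} (d e : Dist A) (h : A → ℚ) →
  expect (d ++ e) h ≡ expect d h + expect e h
expect-++ []            e h = sym (+-identityˡ _)
expect-++ ((w , x) ∷ d) e h =
  trans (cong (w * h x +_) (expect-++ d e h)) (sym (+-assoc (w * h x) _ _))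

-- Stated for any g that acts as the reweighting, since the one inside bindD is an anonymous lambda.
expect-reweight : {A : Set} (w : ℚ) (g : ℚ × A → ℚ × A) → (∀ v y → g (v , y) ≡ (w * v , y)) →
  (d : Dist A) (h : A → ℚ) → expect (List.map g d) h ≡ w * expect d h
expect-reweight w g g-spec []            h = sym (*-zeroʳ w)
expect-reweight w g g-spec ((v , y) ∷ d) h rewrite g-spec v y =
  trans (cong₂ _+_ (*-assoc w v (h y)) (expect-reweight w g g-spec d h))
        (sym (*-distribˡ-+ w _ _))

expect-bindD : {A B : Set} (d : Dist A) (g : A → Dist B) (h : B → ℚ) →
  expect (bindD d g) h ≡ expect d (λ x → expect (g x) h)
expect-bindD []            g h = refl
expect-bindD ((w , x) ∷ d) g h =
  trans (expect-++ (List.map _ (g x)) _ h)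
        (cong₂ _+_ (expect-reweight w _ (λ _ _ → refl) (g x) h) (expect-bindD d g h))

expect-mapD : {A B : Set} (f : A → B) (d : Dist A) (h : B → ℚ) →
  expect (mapD f d) h ≡ expect d (h ∘ f)
expect-mapD f []            h = refl
expect-mapD f ((w , x) ∷ d) h = cong (w * h (f x) +_) (expect-mapD f d h)

expect-cong : {A : Set} (d : Dist A) {g h : A → ℚ} → (∀ x → g x ≡ h x) →
  expect d g ≡ expect d h
expect-cong []            g≗h = refl
expect-cong ((w , x) ∷ d) g≗h = cong₂ (λ a b → w * a + b) (g≗h x) (expect-cong d g≗h)

NonNegativeWeights : {A : Set} → Dist A → Set
NonNegativeWeights = List.foldr (λ { (w , _) P → (0ℚ ≤ℚ w) × P }) (0ℚ ≡ 0ℚ)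

expect-mono : {A : Set} (P : A → Set) (d : Dist A) {g h : A → ℚ} →
  NonNegativeWeights d → AllOutcomes P d → (∀ x → P x → g x ≤ℚ h x) →
  expect d g ≤ℚ expect d h
expect-mono P []            _            _          g≤h = ≤-refl
expect-mono P ((w , x) ∷ d) (0≤w , 0≤ws) (Px , Pxs) g≤h =
  +-mono-≤ (*-monoˡ-≤-nonNeg w {{nonNegative 0≤w}} (g≤h x Px))
           (expect-mono P d 0≤ws Pxs g≤h)

module RankBy {n L : ℕ} (φ : Fin n → Fin L) where

  below : Fin n → Subset n
  below x = tabulate λ y → does (φ y <? φ x)

  ∈-below⁺ : ∀ {x y} → φ y <ᶠ φ x → y ∈ below x
  ∈-below⁺ {x} {y} φy<φx =
    lookup⇒[]= y (below x) (trans (lookup∘tabulate _ y) (dec-true (φ y <? φ x) φy<φx))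

  ∈-below⁻ : ∀ {x y} → y ∈ below x → φ y <ᶠ φ x
  ∈-below⁻ {x} {y} y∈ =
    invert (subst (Reflects _) (trans (sym (lookup∘tabulate _ y)) ([]=⇒lookup y∈))
                  (proof (φ y <? φ x)))

  ∉-below-self : ∀ x → ¬ x ∈ below x
  ∉-below-self x x∈ = <-irrefl refl (∈-below⁻ x∈)

  below⊂⊤ : ∀ x → below x ⊂ ⊤
  below⊂⊤ x = (λ _ → ∈⊤) , x , ∈⊤ , ∉-below-self x

  below-⊂ : ∀ {x y} → φ x <ᶠ φ y → below x ⊂ below y
  below-⊂ {x} {y} φx<φy =
    (λ z∈ → ∈-below⁺ (<-trans (∈-below⁻ z∈) φx<φy)) , x , ∈-below⁺ φx<φy , ∉-below-self x

  ∣below∣<n : ∀ x → ∣ below x ∣ < n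
  ∣below∣<n x = subst (∣ below x ∣ <_) (∣⊤∣≡n n) (p⊂q⇒∣p∣<∣q∣ (below⊂⊤ x))

  rankBy : Fin n → Fin n
  rankBy x = fromℕ< (∣below∣<n x)

  rankBy-mono : ∀ {x y} → φ x <ᶠ φ y → rankBy x <ᶠ rankBy y
  rankBy-mono {x} {y} φx<φy =
    subst₂ _<_ (sym (toℕ-fromℕ< (∣below∣<n x))) (sym (toℕ-fromℕ< (∣below∣<n y)))
      (p⊂q⇒∣p∣<∣q∣ (below-⊂ φx<φy))

  module _ (φ-inj : Injective _≡_ _≡_ φ) where

    rankBy-reflects : ∀ {x y} → rankBy x <ᶠ rankBy y → φ x <ᶠ φ y
    rankBy-reflects {x} {y} r< with <-cmp (φ x) (φ y)
    ... | tri< φx<φy _ _ = φx<φy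
    ... | tri≈ _ φx≡φy _ rewrite φ-inj φx≡φy = contradiction r< (<-irrefl refl)
    ... | tri> _ _ φy<φx = contradiction (rankBy-mono φy<φx) (<-asym r<)

    rankBy-injective : Injective _≡_ _≡_ rankBy
    rankBy-injective {x} {y} r≡ with <-cmp (φ x) (φ y)
    ... | tri< φx<φy _ _ = contradiction (rankBy-mono φx<φy) (<-irrefl (cong toℕ r≡))
    ... | tri≈ _ φx≡φy _ = φ-inj φx≡φy
    ... | tri> _ _ φy<φx = contradiction (rankBy-mono φy<φx) (<-irrefl (cong toℕ (sym r≡)))

phyValue-substitute : ∀ {k m n} (f : LTree (Fin k) → ℚ) (G : Dist (Vec (Fin m) k))
  (I : Dist (Vec (Fin n) m)) (T : Tree) (φ : Fin n → Fin (size T)) →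
  phyValue f (bindD I (λ z → mapD (Vec.map (lookup z)) G)) T φ
    ≡ expect I (λ z → phyValue f G T (φ ∘ lookup z))
phyValue-substitute f G I T φ = begin
  phyValue f (bindD I (λ z → mapD (Vec.map (lookup z)) G)) T φ
    ≡⟨ expect-bindD I _ _ ⟩
  expect I (λ z → expect (mapD (Vec.map (lookup z)) G) (payoff f T ∘ Vec.map φ))
    ≡⟨ expect-cong I (λ z → expect-mapD _ G _) ⟩
  expect I (λ z → expect G (payoff f T ∘ Vec.map φ ∘ Vec.map (lookup z)))
    ≡⟨ expect-cong I (λ z → expect-cong G (λ a → cong (payoff f T) (sym (map-∘ φ (lookup z) a)))) ⟩
  expect I (λ z → phyValue f G T (φ ∘ lookup z))
    ∎
  where open ≡-Reasoning

open RankBy using (rankBy; rankBy-mono; rankBy-reflects; rankBy-injective)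

orderIs-rankBy : ∀ {m n} (T : Tree) (φ : Fin n → Fin (size T)) → Injective _≡_ _≡_ φ →
  (z : Vec (Fin n) m) → OrderIs T (φ ∘ lookup z) z (rankBy φ)
orderIs-rankBy T φ φ-inj z i j = rankBy-mono φ , rankBy-reflects φ φ-inj

claim2 : (k d : ℕ) → 1 ≤ k → 1 ≤ d
    → (f : LTree (Fin k) → ℚ) → (∀ p → (0ℚ ≤ℚ f p) × (f p ≤ℚ 1ℚ))
    → (o : {n : ℕ} → Vec (Fin n) (k ^ d) → (Fin n → Fin n) → ℚ)
    → (∀ {n} (z : Vec (Fin n) (k ^ d)) (σ : Fin n → Fin n) →
    Injective _≡_ _≡_ (lookup z) → Injective _≡_ _≡_ σ → IsOptGiven k d f z σ (o z σ))
    → (n : ℕ) (I : Dist (Vec (Fin n) (k ^ d)))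
    → IsDist I → AllOutcomes (λ z → Injective _≡_ _≡_ (lookup z)) I
    → (T : Tree) (φ : Fin n → Fin (size T)) → Injective _≡_ _≡_ φ
    → Σ[ σ ∈ (Fin n → Fin n) ]
    (Injective _≡_ _≡_ σ × phyValue f (hOrdPhy k d I) T φ ≤ℚ ordValue o I σ)
claim2 k d _ _ f _ o o-opt n I (0≤I , _) I-inj T φ φ-inj = σ , σ-inj , value≤
  where
  σ : Fin n → Fin n
  σ = rankBy φ

  σ-inj : Injective _≡_ _≡_ σ
  σ-inj = rankBy-injective φ φ-inj

  copy≤o : ∀ z → Injective _≡_ _≡_ (lookup z) → phyValue f (gap k d) T (φ ∘ lookup z) ≤ℚ o z σ
  copy≤o z z-inj =
    proj₂ (o-opt z σ z-inj σ-inj) T (φ ∘ lookup z) (z-inj ∘ φ-inj) (orderIs-rankBy T φ φ-inj z)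

  value≤ : phyValue f (hOrdPhy k d I) T φ ≤ℚ ordValue o I σ
  value≤ = begin
    phyValue f (hOrdPhy k d I) T φ                         ≡⟨ phyValue-substitute f (gap k d) I T φ ⟩
    expect I (λ z → phyValue f (gap k d) T (φ ∘ lookup z)) ≤⟨ expect-mono _ I 0≤I I-inj copy≤o ⟩
    ordValue o I σ                                         ∎
    where open ℚ-≤-Reasoning
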